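{- Every connected graph $G$ satisfies $\mathrm{disp}_2(G)\ge\nu(G)$, where $\nu(G)$ is the maximum cardinality of a matching in $G$.
   Context: All graphs are finite, undirected and connected, and every edge is regarded as a rectifiable curve of length $1$. For a graph $G=(V,E)$, $P(G)$ denotes the set of all points on all edges (interior points) together with all vertices. For $p,q\in P(G)$, $d(p,q)$ is the length of a shortest path between $p$ and $q$ in this metric space. For a real $\delta>0$, a set $S\subset P(G)$ is $\delta$-dispersed if $d(p,q)\ge\delta$ for all distinct $p,q\in S$. The $\delta$-dispersion number $\mathrm{disp}_\delta(G)$ is the maximum cardinality of a $\delta$-dispersed subset of $P(G)$. -}

module Defs where

open import Data.Nat using (ℕ; zero; suc)
open import Data.Fin using (Fin)
open import Data.Integer using (+_)
open import Data.Rational using (ℚ; 0ℚ; 1ℚ; _+_; _-_; _<_; _≤_; ∣_∣; _/_)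
open import Data.List using (List)
open import Data.List.Relation.Unary.AllPairs using (AllPairs)
open import Data.Product using (Σ; _×_; _,_)
open import Relation.Binary.PropositionalEquality using (_≡_; _≢_)
open import Relation.Nullary using (¬_)

ℕtoℚ : ℕ → ℚ
ℕtoℚ k = (+ k) / 1

record Graph : Set₁ where
  field
    n     : ℕ
    Adj   : Fin n → Fin n → Set
    sym   : ∀ {u v} → Adj u v → Adj v u
    irrefl : ∀ {u} → ¬ Adj u u

module _ (G : Graph) where
  open Graph G

  data Walk : Fin n → Fin n → ℕ → Set where
    nil  : ∀ {u} → Walk u u 0
    cons : ∀ {u w v k} → Adj u w → Walk w v k → Walk u v (suc k)

  Connected : Set
  Connected = ∀ u v → Σ ℕ λ k → Walk u v k

  -- Points of the metric graph P(G): a vertex, or an interior point of the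
  -- edge uv at distance t ∈ (0,1) from u (then distance 1 - t from v).
  data Point : Set where
    vtx   : Fin n → Point
    inner : (u v : Fin n) → Adj u v → (t : ℚ) → 0ℚ < t → t < 1ℚ → Point

  -- Exit p a c : from point p one reaches vertex a along p's edge with length c.
  data Exit : Point → Fin n → ℚ → Set where
    self  : ∀ {v} → Exit (vtx v) v 0ℚ
    left  : ∀ {u v e t p q} → Exit (inner u v e t p q) u t
    right : ∀ {u v e t p q} → Exit (inner u v e t p q) v (1ℚ - t)

  -- Route p q ℓ : ℓ is the length of some path from p to q in P(G) of one of
  -- the possible shapes; the distance d(p,q) is the infimum of these lengths.
  data Route : Point → Point → ℚ → Set where
    via  : ∀ {p q a b c c' k} → Exit p a c → Walk a b k → Exit q b c' →
           Route p q (c + ℕtoℚ k + c')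
    same : ∀ {u v e e' t s p₁ p₂ q₁ q₂} →
           Route (inner u v e t p₁ p₂) (inner u v e' s q₁ q₂) ∣ t - s ∣
    flip : ∀ {u v e e' t s p₁ p₂ q₁ q₂} →
           Route (inner u v e t p₁ p₂) (inner v u e' s q₁ q₂) ∣ 1ℚ - s - t ∣

  DistAtLeast : ℚ → Point → Point → Set
  DistAtLeast δ p q = ∀ ℓ → Route p q ℓ → δ ≤ ℓ

  Dispersed : ℚ → List Point → Set
  Dispersed δ S = AllPairs (DistAtLeast δ) S

  Edge : Set
  Edge = Σ (Fin n) λ u → Σ (Fin n) λ v → Adj u v

  Disjoint : Edge → Edge → Set
  Disjoint (a , b , _) (c , d , _) = a ≢ c × a ≢ d × b ≢ c × b ≢ d

  IsMatching : List Edge → Set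
  IsMatching M = AllPairs Disjoint M

-- Place one point at the midpoint of each edge of the matching. Two such
-- midpoints lie on disjoint edges, so any path between them leaves the first
-- edge through an endpoint (length 1/2), reaches the second edge through an
-- endpoint (length 1/2), and in between walks from one endpoint to another,
-- distinct one; that walk has at least one edge. Hence their distance is ≥ 2.
module Submission where

open import Defs
open import Data.Nat as ℕ using (suc; s≤s; z≤n)
open import Data.Integer as ℤ using (+_)
import Data.Integer.Properties as ℤ
open import Data.Rational using (ℚ; mkℚ; 0ℚ; 1ℚ; _+_; _≤_; _<_; _<?_; *≤*; _/_)
open import Data.Rational.Properties using (+-monoˡ-≤; +-monoʳ-≤; ↥p/↧p≡p; module ≤-Reasoning)
open import Data.Nat.Coprimality using (1-coprimeTo) renaming (sym to coprime-sym)
open import Data.List using (List; length; map)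
open import Data.List.Properties using (length-map)
import Data.List.Relation.Unary.AllPairs as AllPairs
open import Data.List.Relation.Unary.AllPairs.Properties using (map⁺)
open import Data.Product using (Σ; _×_; _,_)
open import Data.Empty using (⊥-elim)
open import Data.Unit using (tt)
open import Relation.Nullary.Decidable using (toWitness)
open import Relation.Binary.PropositionalEquality using (_≡_; _≢_; refl; sym; subst₂)

½ : ℚ
½ = + 1 / 2

0<½ : 0ℚ < ½
0<½ = toWitness {a? = 0ℚ <? ½} tt

½<1 : ½ < 1ℚ
½<1 = toWitness {a? = ½ <? 1ℚ} tt

ℕtoℚ≡mkℚ : ∀ k → ℕtoℚ k ≡ mkℚ (+ k) 0 (coprime-sym (1-coprimeTo k))
ℕtoℚ≡mkℚ k = ↥p/↧p≡p (mkℚ (+ k) 0 (coprime-sym (1-coprimeTo k)))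

ℕtoℚ-mono-≤ : ∀ {m n} → m ℕ.≤ n → ℕtoℚ m ≤ ℕtoℚ n
ℕtoℚ-mono-≤ {m} {n} m≤n rewrite ℕtoℚ≡mkℚ m | ℕtoℚ≡mkℚ n =
  *≤* (subst₂ ℤ._≤_ (sym (ℤ.*-identityʳ (+ m))) (sym (ℤ.*-identityʳ (+ n))) (ℤ.+≤+ m≤n))

½+ℕtoℚ-suc+½-≥-2 : ∀ k → ℕtoℚ 2 ≤ ½ + ℕtoℚ (suc k) + ½
½+ℕtoℚ-suc+½-≥-2 k = begin
  ℕtoℚ 2                ≡⟨ refl ⟩
  ½ + ℕtoℚ 1 + ½        ≤⟨ +-monoˡ-≤ ½ (+-monoʳ-≤ ½ (ℕtoℚ-mono-≤ {n = suc k} (s≤s z≤n))) ⟩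
  ½ + ℕtoℚ (suc k) + ½  ∎
  where open ≤-Reasoning

module _ (G : Graph) where
  open Graph G

  midpoint : Edge G → Point G
  midpoint (u , v , e) = inner u v e ½ 0<½ ½<1

  ½+walk+½-≥-2 : ∀ {x y k} → Walk G x y k → x ≢ y → ℕtoℚ 2 ≤ ½ + ℕtoℚ k + ½
  ½+walk+½-≥-2 nil                x≢y = ⊥-elim (x≢y refl)
  ½+walk+½-≥-2 (cons {k = k} _ _) _ = ½+ℕtoℚ-suc+½-≥-2 k

  -- Every exit from a midpoint has length ½: for the right one, 1 - ½ reduces
  -- to ½ by computation.
  midpoints-of-disjoint-edges-far : ∀ {e e'} → Disjoint G e e' →
    DistAtLeast G (ℕtoℚ 2) (midpoint e) (midpoint e')
  midpoints-of-disjoint-edges-far (a≢c , a≢d , b≢c , b≢d) _ route with route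
  ... | via left  w left  = ½+walk+½-≥-2 w a≢c
  ... | via left  w right = ½+walk+½-≥-2 w a≢d
  ... | via right w left  = ½+walk+½-≥-2 w b≢c
  ... | via right w right = ½+walk+½-≥-2 w b≢d
  ... | same              = ⊥-elim (a≢c refl)
  ... | flip              = ⊥-elim (a≢d refl)

lemma9 : (G : Graph) → Connected G → (M : List (Edge G)) → IsMatching G M →
    Σ (List (Point G)) λ S → length S ≡ length M × Dispersed G (ℕtoℚ 2) S
lemma9 G _ M matching =
  map (midpoint G) M ,
  length-map (midpoint G) M ,
  map⁺ (AllPairs.map (midpoints-of-disjoint-edges-far G) matching)
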